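{- Let $(G,D,w)$ be an instance of metric Multi-Depot Multiple TSP with integer weights and $d=|D|$, and suppose there is a constant $L$ such that for every nonempty proper subset $U\subsetneq V(G)$ we have $\min\{w(u,v)\mid u\in U,\ v\notin U\}\le L$. Then the Multi-Depot Christofides–Serdyukov algorithm returns a tour $T$ of $(G,D,w)$ with $w(T)\le\frac32\operatorname{OPT}(G,D,w)+L(d-1)$.
   Context: An instance $(G,D,w)$ of metric Multi-Depot Multiple TSP consists of a complete graph $G$, a set $D\subseteq V(G)$ of depots, and a metric $w$ on $V(G)$ (edge weights). A tour is a multiset $T$ of edges such that every node has even degree in $(V(G),T)$ and every connected component of $(V(G),T)$ contains a depot; $\operatorname{OPT}(G,D,w)$ is the minimum tour weight (weights summed with multiplicity). A constrained spanning forest (CSF) of $(G,D)$ is an acyclic edge set $F$ such that every connected component of $(V(G),F)$ contains a node of $D$. The Multi-Depot Christofides–Serdyukov algorithm computes a minimum-weight CSF $F$, lets $U$ be the set of nodes of odd degree in $(V(G),F)$, computes a minimum-weight perfect matching $M$ of the complete graph on $U$, and returns $F\,\dot\cup\,M$. -}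

module Defs where

open import Data.Nat using (ℕ; zero; suc; _+_; _*_; _∸_; _≤_; _%_)
open import Data.Fin using (Fin)
open import Data.Fin.Properties using () renaming (_≟_ to _≟ᶠ_)
open import Data.Fin.Subset using (Subset; _∈_; _∉_)
open import Data.List using (List; []; _∷_; _++_; [_]; length)
open import Data.List.Relation.Unary.Any using (Any)
open import Data.List.Relation.Unary.AllPairs using (AllPairs)
open import Data.List.Relation.Unary.All using (All)
open import Data.List.Relation.Unary.Unique.Propositional using (Unique)
open import Data.Product using (_×_; _,_; Σ; ∃; ∃-syntax; swap)
open import Data.Sum using (_⊎_)
open import Data.Unit using (⊤)
open import Relation.Nullary using (¬_; Dec; yes; no)
open import Relation.Binary.PropositionalEquality using (_≡_; _≢_)

-- Vertices of the complete graph G are Fin n.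
-- An edge of G is an ordered pair of distinct vertices, read as unordered.
Edge : ℕ → Set
Edge n = Fin n × Fin n

-- Multisets of edges are lists of edges (order irrelevant, multiplicity counts).
EdgeList : ℕ → Set
EdgeList n = List (Edge n)

record IsMetric {n : ℕ} (w : Fin n → Fin n → ℕ) : Set where
  field
    zero-iff : ∀ u v → w u v ≡ 0 → u ≡ v
    refl-zero : ∀ v → w v v ≡ 0
    symmetric : ∀ u v → w u v ≡ w v u
    triangle : ∀ u v x → w u x ≤ w u v + w v x

weight : ∀ {n} → (Fin n → Fin n → ℕ) → EdgeList n → ℕ
weight w [] = 0
weight w ((u , v) ∷ es) = w u v + weight w es

NoLoops : ∀ {n} → EdgeList n → Set
NoLoops es = All (λ e → Data.Product.proj₁ e ≢ Data.Product.proj₂ e) es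

indic : ∀ {n} → Fin n → Fin n → ℕ
indic a v with a ≟ᶠ v
... | yes _ = 1
... | no _ = 0

deg : ∀ {n} → EdgeList n → Fin n → ℕ
deg [] v = 0
deg ((a , b) ∷ es) v = indic a v + indic b v + deg es v

SameEdge : ∀ {n} → Edge n → Edge n → Set
SameEdge e e' = (e ≡ e') ⊎ (swap e ≡ e')

EdgeIn : ∀ {n} → Edge n → EdgeList n → Set
EdgeIn e es = Any (SameEdge e) es

data Connected {n : ℕ} (es : EdgeList n) : Fin n → Fin n → Set where
  here : ∀ {u} → Connected es u u
  step : ∀ {u x v} → EdgeIn (u , x) es → Connected es x v → Connected es u v

ComponentsHaveDepot : ∀ {n} → Subset n → EdgeList n → Set
ComponentsHaveDepot {n} D es = ∀ (v : Fin n) → ∃[ d ] (d ∈ D × Connected es v d)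

WalkIn : ∀ {n} → EdgeList n → List (Fin n) → Set
WalkIn es [] = ⊤
WalkIn es (x ∷ []) = ⊤
WalkIn es (x ∷ y ∷ r) = EdgeIn (x , y) es × WalkIn es (y ∷ r)

HasCycle : ∀ {n} → EdgeList n → Set
HasCycle {n} es =
  Σ (Fin n) λ v0 → Σ (List (Fin n)) λ rest →
    (2 ≤ length rest) × Unique (v0 ∷ rest) × WalkIn es ((v0 ∷ rest) ++ [ v0 ])

-- acyclic edge set of G: a set (no repeated edges, which would form a
-- 2-cycle), edges of G (no loops), and no cycle
Acyclic : ∀ {n} → EdgeList n → Set
Acyclic es = NoLoops es × AllPairs (λ e e' → ¬ SameEdge e e') es × ¬ HasCycle es

IsCSF : ∀ {n} → Subset n → EdgeList n → Set
IsCSF D F = Acyclic F × ComponentsHaveDepot D F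

IsMinCSF : ∀ {n} → (Fin n → Fin n → ℕ) → Subset n → EdgeList n → Set
IsMinCSF {n} w D F = IsCSF D F × (∀ (F' : EdgeList n) → IsCSF D F' → weight w F ≤ weight w F')

OddDeg : ∀ {n} → EdgeList n → Fin n → Set
OddDeg F v = deg F v % 2 ≡ 1

IsPerfectMatchingOnOdd : ∀ {n} → EdgeList n → EdgeList n → Set
IsPerfectMatchingOnOdd {n} F M =
  NoLoops M
  × All (λ e → OddDeg F (Data.Product.proj₁ e) × OddDeg F (Data.Product.proj₂ e)) M
  × (∀ (v : Fin n) → OddDeg F v → deg M v ≡ 1)

IsMinPerfectMatchingOnOdd : ∀ {n} → (Fin n → Fin n → ℕ) → EdgeList n → EdgeList n → Set
IsMinPerfectMatchingOnOdd {n} w F M =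
  IsPerfectMatchingOnOdd F M
  × (∀ (M' : EdgeList n) → IsPerfectMatchingOnOdd F M' → weight w M ≤ weight w M')

AllEven : ∀ {n} → EdgeList n → Set
AllEven {n} T = ∀ (v : Fin n) → deg T v % 2 ≡ 0

IsTour : ∀ {n} → Subset n → EdgeList n → Set
IsTour D T = NoLoops T × AllEven T × ComponentsHaveDepot D T

CutBound : ∀ {n} → (Fin n → Fin n → ℕ) → ℕ → Set
CutBound {n} w L =
  ∀ (U : Subset n) → (∃[ u ] u ∈ U) → (∃[ v ] v ∉ U) →
    ∃[ u ] ∃[ v ] (u ∈ U × v ∉ U × w u v ≤ L)

-- Let T be any tour. Dropping edges of T that join vertices already connected by the others
-- leaves a constrained spanning forest, so w(F) ≤ w(T). Joining the component of one depot to
-- another component by a doubled edge across the cut, at most d − 1 times and each time of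
-- weight at most 2L, makes T into a connected even multigraph H with w(H) ≤ w(T) + 2L(d − 1).
-- Walking in H between the endpoints of every edge of F splits the edges of H into two parts,
-- each with the degree parities of F; by the triangle inequality the lighter part shortcuts to
-- a perfect matching on the odd vertices of F, so w(M) ≤ w(H)/2. Hence
-- 2 w(F ∪ M) ≤ 2 w(T) + w(H) ≤ 3 w(T) + 2L(d − 1).
module Submission where

open import Defs
open import Data.Nat using (ℕ; zero; suc; _+_; _*_; _∸_; _≤_; _<_; _%_; z≤n; s≤s; _≤?_)
open import Data.Nat.Properties hiding (_≟_)
open import Data.Nat.DivMod using (%-distribˡ-+; [m+kn]%n≡m%n; m≤n⇒m%n≡m; m%n<n)
open import Data.Nat.Solver using (module +-*-Solver)
open import Data.Fin using (Fin)
open import Data.Fin.Properties using (_≟_; any?)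
open import Data.Fin.Subset using (Subset; Nonempty; ∣_∣; _∈_; _⊂_)
open import Data.Fin.Subset.Properties using (_∈?_; p⊂q⇒∣p∣<∣q∣)
open import Data.List using (List; []; _∷_; _++_; [_]; length)
open import Data.List.Properties using (++-assoc; length-++-sucʳ)
import Data.List.Membership.Propositional as List
open import Data.List.Relation.Unary.Any as Any using (Any; here; there)
import Data.List.Relation.Unary.Any.Properties as Any
open import Data.List.Relation.Unary.All as All using (All; []; _∷_)
import Data.List.Relation.Unary.All.Properties as All
open import Data.List.Relation.Unary.AllPairs using (AllPairs; []; _∷_)
open import Data.List.Relation.Binary.Permutation.Propositional as ↭ using (_↭_; ↭-sym; ↭-trans; ↭-refl)
open import Data.List.Relation.Binary.Permutation.Propositional.Properties
  using (shift; Any-resp-↭; All-resp-↭; ↭-length; ++⁺ˡ; ++⁺ʳ)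
open import Data.Product using (_×_; _,_; ∃; ∃₂; proj₁; proj₂)
open import Data.Sum using (_⊎_; inj₁; inj₂)
open import Data.Vec using (tabulate)
open import Data.Vec.Properties using ([]=⇒lookup; lookup⇒[]=; lookup∘tabulate)
open import Function using (_∘_)
open import Relation.Nullary using (¬_; Dec; yes; no; does; contradiction; ¬?; _×-dec_)
open import Relation.Nullary.Decidable using (dec-true)
open import Relation.Binary.PropositionalEquality hiding ([_])

open +-*-Solver using (solve; _:+_; _:*_; _:=_; con)

private variable
  n : ℕ

extractAny : {A : Set} {P : A → Set} {xs : List A} → Any P xs → ∃₂ λ x rest → P x × xs ↭ x ∷ rest
extractAny (here p) = _ , _ , p , ↭-refl
extractAny {xs = y ∷ _} (there any) with extractAny any
... | x , rest , p , xs↭ = x , y ∷ rest , p , ↭-trans (↭.prep y xs↭) (↭.swap y x ↭-refl)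

Any-split : {A : Set} {P : A → Set} {xs : List A} → Any P xs → ∃ λ pre → ∃ λ x → ∃ λ post → xs ≡ pre ++ x ∷ post × P x
Any-split {xs = x ∷ xs} (here p) = [] , x , xs , refl , p
Any-split {xs = y ∷ xs} (there any) with Any-split any
... | pre , x , post , refl , p = y ∷ pre , x , post , refl , p

Any-drop : {A : Set} {P : A → Set} (xs : List A) {x : A} {ys : List A} → Any P (xs ++ x ∷ ys) → P x ⊎ Any P (xs ++ ys)
Any-drop [] (here p) = inj₁ p
Any-drop [] (there any) = inj₂ any
Any-drop (y ∷ xs) (here p) = inj₂ (here p)
Any-drop (y ∷ xs) (there any) with Any-drop xs any
... | inj₁ p = inj₁ p
... | inj₂ any′ = inj₂ (there any′)

All-fromSplits : {A : Set} {P : A → Set} (xs : List A) → (∀ pre x post → xs ≡ pre ++ x ∷ post → P x) → All P xs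
All-fromSplits [] f = []
All-fromSplits (x ∷ xs) f = f [] x xs refl ∷ All-fromSplits xs (λ pre y post eq → f (x ∷ pre) y post (cong (x ∷_) eq))

AllPairs-fromSplits : {A : Set} {R : A → A → Set} (xs : List A) →
  (∀ pre x mid y post → xs ≡ pre ++ x ∷ mid ++ y ∷ post → R x y) → AllPairs R xs
AllPairs-fromSplits [] f = []
AllPairs-fromSplits (x ∷ xs) f =
  All-fromSplits xs (λ mid y post eq → f [] x mid y post (cong (x ∷_) eq))
  ∷ AllPairs-fromSplits xs (λ pre y mid z post eq → f (x ∷ pre) y mid z post (cong (x ∷_) eq))

module _ {A : Set} (R : List A → A → List A → Set) (R? : ∀ pre x post → Dec (R pre x post)) where

  findSplit : ∀ pre xs →
    (∃ λ mid → ∃ λ x → ∃ λ post → xs ≡ mid ++ x ∷ post × R (pre ++ mid) x post)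
    ⊎ (∀ mid x post → xs ≡ mid ++ x ∷ post → ¬ R (pre ++ mid) x post)
  findSplit pre [] = inj₂ λ { [] _ _ () ; (_ ∷ _) _ _ () }
  findSplit pre (x ∷ xs) with R? (pre ++ []) x xs | findSplit (pre ++ [ x ]) xs
  ... | yes r | _ = inj₁ ([] , x , xs , refl , r)
  ... | no _ | inj₁ (mid , y , post , refl , r) =
    inj₁ (x ∷ mid , y , post , refl , subst (λ p → R p y post) (++-assoc pre [ x ] mid) r)
  ... | no ¬r | inj₂ none = inj₂ λ where
    [] _ _ refl → ¬r
    (_ ∷ mid) y post refl r → none mid y post refl (subst (λ p → R p y post) (sym (++-assoc pre [ x ] mid)) r)

indic-refl : (a : Fin n) → indic a a ≡ 1
indic-refl a with a ≟ a
... | yes _ = refl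
... | no a≢a = contradiction refl a≢a

indic-≢ : {a v : Fin n} → a ≢ v → indic a v ≡ 0
indic-≢ {a = a} {v} a≢v with a ≟ v
... | yes a≡v = contradiction a≡v a≢v
... | no _ = refl

ends : Edge n → Fin n → ℕ
ends (a , b) v = indic a v + indic b v

ends-SameEdge : {e f : Edge n} → SameEdge e f → ∀ v → ends e v ≡ ends f v
ends-SameEdge (inj₁ refl) v = refl
ends-SameEdge {e = a , b} (inj₂ refl) v = +-comm (indic a v) (indic b v)

weight-SameEdge : {w : Fin n → Fin n → ℕ} → IsMetric w → {a b c d : Fin n} →
  SameEdge (a , b) (c , d) → w a b ≡ w c d
weight-SameEdge met (inj₁ refl) = refl
weight-SameEdge met (inj₂ refl) = IsMetric.symmetric met _ _

x+[y+z]≡y+[x+z] : ∀ x y z → x + (y + z) ≡ y + (x + z)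
x+[y+z]≡y+[x+z] x y z = solve 3 (λ x y z → x :+ (y :+ z) := y :+ (x :+ z)) refl x y z

deg-++ : (A B : EdgeList n) (v : Fin n) → deg (A ++ B) v ≡ deg A v + deg B v
deg-++ [] B v = refl
deg-++ (e ∷ A) B v = trans (cong (ends e v +_) (deg-++ A B v)) (sym (+-assoc (ends e v) (deg A v) (deg B v)))

weight-++ : (w : Fin n → Fin n → ℕ) (A B : EdgeList n) → weight w (A ++ B) ≡ weight w A + weight w B
weight-++ w [] B = refl
weight-++ w ((a , b) ∷ A) B = trans (cong (w a b +_) (weight-++ w A B)) (sym (+-assoc (w a b) (weight w A) (weight w B)))

deg-↭ : {A B : EdgeList n} → A ↭ B → ∀ v → deg A v ≡ deg B v
deg-↭ ↭.refl v = refl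
deg-↭ (↭.prep e p) v = cong (ends e v +_) (deg-↭ p v)
deg-↭ (↭.swap e f p) v = trans (x+[y+z]≡y+[x+z] (ends e v) (ends f v) _) (cong (λ d → ends f v + (ends e v + d)) (deg-↭ p v))
deg-↭ (↭.trans p q) v = trans (deg-↭ p v) (deg-↭ q v)

weight-↭ : (w : Fin n → Fin n → ℕ) {A B : EdgeList n} → A ↭ B → weight w A ≡ weight w B
weight-↭ w ↭.refl = refl
weight-↭ w (↭.prep (a , b) p) = cong (w a b +_) (weight-↭ w p)
weight-↭ w (↭.swap (a , b) (c , d) p) = trans (x+[y+z]≡y+[x+z] (w a b) (w c d) _) (cong (λ s → w c d + (w a b + s)) (weight-↭ w p))
weight-↭ w (↭.trans p q) = trans (weight-↭ w p) (weight-↭ w q)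

infix 4 _≡₂_

-- A record rather than  m % 2 ≡ n % 2,  so that m and n can be inferred from a proof.
record _≡₂_ (m n : ℕ) : Set where
  constructor mod2
  field mod2-≡ : m % 2 ≡ n % 2
open _≡₂_

≡⇒≡₂ : ∀ {m n} → m ≡ n → m ≡₂ n
≡⇒≡₂ m≡n = mod2 (cong (_% 2) m≡n)

≡₂-sym : ∀ {m n} → m ≡₂ n → n ≡₂ m
≡₂-sym (mod2 p) = mod2 (sym p)

≡₂-trans : ∀ {m n o} → m ≡₂ n → n ≡₂ o → m ≡₂ o
≡₂-trans (mod2 p) (mod2 q) = mod2 (trans p q)

+-congˡ-≡₂ : ∀ c {m n} → m ≡₂ n → c + m ≡₂ c + n
+-congˡ-≡₂ c {m} {n} (mod2 p) = mod2 (begin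
  (c + m) % 2           ≡⟨ %-distribˡ-+ c m 2 ⟩
  (c % 2 + m % 2) % 2   ≡⟨ cong (λ r → (c % 2 + r) % 2) p ⟩
  (c % 2 + n % 2) % 2   ≡⟨ %-distribˡ-+ c n 2 ⟨
  (c + n) % 2           ∎)
  where open ≡-Reasoning

m+[m+n]≡₂n : ∀ m n → m + (m + n) ≡₂ n
m+[m+n]≡₂n m n = mod2 (trans (cong (_% 2) (solve 2 (λ m n → m :+ (m :+ n) := n :+ m :* con 2) refl m n)) ([m+kn]%n≡m%n n m 2))

≤1∧≡₂⇒≡%2 : ∀ {m n} → m ≤ 1 → m ≡₂ n → m ≡ n % 2
≤1∧≡₂⇒≡%2 {m} m≤1 (mod2 p) = trans (sym (m≤n⇒m%n≡m m≤1)) p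

%2≡0⊎%2≡1 : ∀ m → m % 2 ≡ 0 ⊎ m % 2 ≡ 1
%2≡0⊎%2≡1 m with m % 2 | m%n<n m 2
... | 0 | _ = inj₁ refl
... | 1 | _ = inj₂ refl
... | suc (suc _) | s≤s (s≤s ())

SameParity : EdgeList n → EdgeList n → Set
SameParity A B = ∀ v → deg A v ≡₂ deg B v

SameEdge-flip : {u x : Fin n} {e : Edge n} → SameEdge (u , x) e → SameEdge (x , u) e
SameEdge-flip (inj₁ refl) = inj₂ refl
SameEdge-flip (inj₂ refl) = inj₁ refl

EdgeIn-flip : {u x : Fin n} {es : EdgeList n} → EdgeIn (u , x) es → EdgeIn (x , u) es
EdgeIn-flip = Any.map SameEdge-flip

module _ {es : EdgeList n} where

  connected-trans : ∀ {u v x} → Connected es u v → Connected es v x → Connected es u x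
  connected-trans here c = c
  connected-trans (step e c) d = step e (connected-trans c d)

  connected-edge : ∀ {u v} → EdgeIn (u , v) es → Connected es u v
  connected-edge e = step e here

  connected-sym : ∀ {u v} → Connected es u v → Connected es v u
  connected-sym here = here
  connected-sym (step e c) = connected-trans (connected-sym c) (connected-edge (EdgeIn-flip e))

connected-mono : {A B : EdgeList n} → (∀ {e} → EdgeIn e A → EdgeIn e B) → ∀ {u v} → Connected A u v → Connected B u v
connected-mono A⊆B here = here
connected-mono A⊆B (step e c) = step (A⊆B e) (connected-mono A⊆B c)

connected-∷ : {es : EdgeList n} {e : Edge n} {u v : Fin n} → Connected es u v → Connected (e ∷ es) u v
connected-∷ = connected-mono there

-- Deciding connectivity: label every vertex by a representative of its component, merging the
-- classes of the endpoints edge by edge.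
redirect : Fin n → Fin n → Fin n → Fin n
redirect a b x with x ≟ b
... | yes _ = a
... | no _ = x

redirect-source : (a b : Fin n) → redirect a b a ≡ a
redirect-source a b with a ≟ b
... | yes _ = refl
... | no _ = refl

redirect-target : (a b : Fin n) → redirect a b b ≡ a
redirect-target a b with b ≟ b
... | yes _ = refl
... | no b≢b = contradiction refl b≢b

representative : EdgeList n → Fin n → Fin n
representative [] v = v
representative ((a , b) ∷ es) v = redirect (representative es a) (representative es b) (representative es v)

connected-representative : (es : EdgeList n) (v : Fin n) → Connected es v (representative es v)
connected-representative [] v = here
connected-representative ((a , b) ∷ es) v with representative es v ≟ representative es b
... | no _ = connected-∷ (connected-representative es v)
... | yes r≡rb = connected-trans (connected-∷ (connected-representative es v))
      (subst (λ r → Connected ((a , b) ∷ es) r (representative es a)) (sym r≡rb)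
        (connected-trans (connected-∷ (connected-sym (connected-representative es b)))
          (step (here (inj₂ refl)) (connected-∷ (connected-representative es a)))))

representative-edge : (es : EdgeList n) {u v : Fin n} → EdgeIn (u , v) es → representative es u ≡ representative es v
representative-edge ((a , b) ∷ es) (here (inj₁ refl)) =
  trans (redirect-source (representative es a) (representative es b)) (sym (redirect-target (representative es a) (representative es b)))
representative-edge ((a , b) ∷ es) (here (inj₂ refl)) =
  trans (redirect-target (representative es a) (representative es b)) (sym (redirect-source (representative es a) (representative es b)))
representative-edge ((a , b) ∷ es) (there e) = cong (redirect (representative es a) (representative es b)) (representative-edge es e)

representative-connected : (es : EdgeList n) {u v : Fin n} → Connected es u v → representative es u ≡ representative es v
representative-connected es here = refl
representative-connected es (step e c) = trans (representative-edge es e) (representative-connected es c)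

connected? : (es : EdgeList n) (u v : Fin n) → Dec (Connected es u v)
connected? es u v with representative es u ≟ representative es v
... | yes ru≡rv = yes (connected-trans (connected-representative es u)
        (subst (λ r → Connected es r v) (sym ru≡rv) (connected-sym (connected-representative es v))))
... | no ru≢rv = no (λ c → ru≢rv (representative-connected es c))

-- Forests

RedundancyFree : EdgeList n → Set
RedundancyFree es = ∀ pre a b post → es ≡ pre ++ (a , b) ∷ post → ¬ Connected (pre ++ post) a b

redundantEdge? : (es : EdgeList n) →
  (∃ λ pre → ∃ λ a → ∃ λ b → ∃ λ post → es ≡ pre ++ (a , b) ∷ post × Connected (pre ++ post) a b)
  ⊎ RedundancyFree es
redundantEdge? es with findSplit (λ pre e post → Connected (pre ++ post) (proj₁ e) (proj₂ e))
                                 (λ pre e post → connected? (pre ++ post) (proj₁ e) (proj₂ e)) [] es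
... | inj₁ (pre , (a , b) , post , eq , c) = inj₁ (pre , a , b , post , eq , c)
... | inj₂ none = inj₂ (λ pre a b post → none pre (a , b) post)

connected-dropRedundant : (pre post : EdgeList n) {a b : Fin n} → Connected (pre ++ post) a b →
  ∀ {u v} → Connected (pre ++ (a , b) ∷ post) u v → Connected (pre ++ post) u v
connected-dropRedundant pre post c here = here
connected-dropRedundant pre post c (step e rest) with Any-drop pre e
... | inj₁ (inj₁ refl) = connected-trans c (connected-dropRedundant pre post c rest)
... | inj₁ (inj₂ refl) = connected-trans (connected-sym c) (connected-dropRedundant pre post c rest)
... | inj₂ e′ = step e′ (connected-dropRedundant pre post c rest)

connected-SameEdge : {es : EdgeList n} {a b c d : Fin n} → SameEdge (a , b) (c , d) → Connected es a b → Connected es c d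
connected-SameEdge (inj₁ refl) c = c
connected-SameEdge (inj₂ refl) c = connected-sym c

Avoids : Fin n → Fin n → Fin n → Set
Avoids v₀ v₁ x = v₀ ≢ x × v₁ ≢ x

¬SameEdge-avoiding : {v₀ v₁ x y : Fin n} {e : Edge n} → SameEdge (v₀ , v₁) e →
  Avoids v₀ v₁ x ⊎ Avoids v₀ v₁ y → ¬ SameEdge (x , y) e
¬SameEdge-avoiding (inj₁ refl) (inj₁ (v₀≢x , _)) (inj₁ refl) = v₀≢x refl
¬SameEdge-avoiding (inj₁ refl) (inj₂ (_ , v₁≢y)) (inj₁ refl) = v₁≢y refl
¬SameEdge-avoiding (inj₁ refl) (inj₁ (_ , v₁≢x)) (inj₂ refl) = v₁≢x refl
¬SameEdge-avoiding (inj₁ refl) (inj₂ (v₀≢y , _)) (inj₂ refl) = v₀≢y refl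
¬SameEdge-avoiding (inj₂ refl) (inj₁ (_ , v₁≢x)) (inj₁ refl) = v₁≢x refl
¬SameEdge-avoiding (inj₂ refl) (inj₂ (v₀≢y , _)) (inj₁ refl) = v₀≢y refl
¬SameEdge-avoiding (inj₂ refl) (inj₁ (v₀≢x , _)) (inj₂ refl) = v₀≢x refl
¬SameEdge-avoiding (inj₂ refl) (inj₂ (_ , v₁≢y)) (inj₂ refl) = v₁≢y refl

-- The first edge v₀ v₁ of a cycle v₀ v₁ y … z v₀ is redundant: every other edge of the cycle
-- has an endpoint among y … z, which differ from v₀ and v₁.
module _ {es : EdgeList n} {v₀ v₁ : Fin n} (pre post : EdgeList n) {e : Edge n}
         (v₀v₁~e : SameEdge (v₀ , v₁) e) (es≡ : es ≡ pre ++ e ∷ post) where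

  edgeIn-avoiding : ∀ {x y} → Avoids v₀ v₁ x ⊎ Avoids v₀ v₁ y → EdgeIn (x , y) es → EdgeIn (x , y) (pre ++ post)
  edgeIn-avoiding avoid xy∈es with Any-drop pre (subst (EdgeIn _) es≡ xy∈es)
  ... | inj₁ xy~e = contradiction xy~e (¬SameEdge-avoiding v₀v₁~e avoid)
  ... | inj₂ xy∈rest = xy∈rest

  connected-avoiding : ∀ x y zs → All (Avoids v₀ v₁) (y ∷ zs) → WalkIn es (x ∷ y ∷ zs ++ [ v₀ ]) → Connected (pre ++ post) x v₀
  connected-avoiding x y [] (avoid-y ∷ []) (xy , yv₀ , _) =
    step (edgeIn-avoiding (inj₂ avoid-y) xy) (connected-edge (edgeIn-avoiding (inj₁ avoid-y) yv₀))
  connected-avoiding x y (z ∷ zs) (avoid-y ∷ avoids) (xy , walk) =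
    step (edgeIn-avoiding (inj₂ avoid-y) xy) (connected-avoiding y z zs avoids walk)

redundancyFree⇒acyclic : {es : EdgeList n} → RedundancyFree es → Acyclic es
redundancyFree⇒acyclic {es = es} free = noLoops , noParallel , noCycle
  where
  noLoops : NoLoops es
  noLoops = All-fromSplits es λ { pre (a , b) post eq refl → free pre a a post eq here }

  noParallel : AllPairs (λ e f → ¬ SameEdge e f) es
  noParallel = AllPairs-fromSplits es λ { pre (a , b) mid f post eq ab~f →
    free pre a b (mid ++ f ∷ post) eq (connected-edge (Any.++⁺ʳ pre (Any.++⁺ʳ mid (here ab~f)))) }

  noCycle : ¬ HasCycle es
  noCycle (v₀ , [] , () , _)
  noCycle (v₀ , _ ∷ [] , s≤s () , _)
  noCycle (v₀ , v₁ ∷ y ∷ zs , _ , ((_ ∷ v₀∉) ∷ (v₁∉ ∷ _)) , (v₀v₁∈es , walk))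
    with Any-split v₀v₁∈es
  ... | pre , (a , b) , post , es≡ , v₀v₁~ab =
    free pre a b post es≡ (connected-SameEdge (SameEdge-flip v₀v₁~ab)
      (connected-avoiding pre post v₀v₁~ab es≡ v₁ y zs (All.zip (v₀∉ , v₁∉)) walk))

weight-dropMiddle : (w : Fin n → Fin n → ℕ) (pre post : EdgeList n) (a b : Fin n) →
  weight w (pre ++ (a , b) ∷ post) ≡ w a b + weight w (pre ++ post)
weight-dropMiddle w pre post a b = weight-↭ w (shift (a , b) pre post)

module _ {D : Subset n} where

  componentsHaveDepot-dropRedundant : (pre post : EdgeList n) {a b : Fin n} →
    ComponentsHaveDepot D (pre ++ (a , b) ∷ post) → Connected (pre ++ post) a b → ComponentsHaveDepot D (pre ++ post)
  componentsHaveDepot-dropRedundant pre post depots c v with depots v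
  ... | d , d∈D , v~d = d , d∈D , connected-dropRedundant pre post c v~d

  pruneToCSF : (w : Fin n → Fin n → ℕ) (fuel : ℕ) (es : EdgeList n) → length es ≤ fuel →
    ComponentsHaveDepot D es → ∃ λ F → IsCSF D F × weight w F ≤ weight w es
  pruneToCSF w fuel es _ depots with redundantEdge? es
  ... | inj₂ free = es , (redundancyFree⇒acyclic free , depots) , ≤-refl
  pruneToCSF w zero _ bound _ | inj₁ (pre , a , b , post , refl , _)
    with () ← ≤-trans (≤-reflexive (sym (length-++-sucʳ pre (a , b) post))) bound
  pruneToCSF w (suc fuel) _ bound depots | inj₁ (pre , a , b , post , refl , c)
    with pruneToCSF w fuel (pre ++ post) (≤-pred (≤-trans (≤-reflexive (sym (length-++-sucʳ pre (a , b) post))) bound))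
                    (componentsHaveDepot-dropRedundant pre post depots c)
  ... | F , csf , F≤ = F , csf , ≤-trans F≤ (≤-trans (m≤n+m _ (w a b)) (≤-reflexive (sym (weight-dropMiddle w pre post a b))))

  minCSF-weight≤ : {w : Fin n → Fin n → ℕ} {F : EdgeList n} → IsMinCSF w D F →
    ∀ {H : EdgeList n} → ComponentsHaveDepot D H → weight w F ≤ weight w H
  minCSF-weight≤ {w} (_ , minimal) {H} depots with pruneToCSF w (length H) H ≤-refl depots
  ... | F′ , csf , F′≤H = ≤-trans (minimal F′ csf) F′≤H

-- Shortcutting

incident : {es : EdgeList n} {v : Fin n} → 1 ≤ deg es v → Any (λ e → ∃ λ x → SameEdge (v , x) e) es
incident {es = []} ()
incident {es = (a , b) ∷ es} {v} pos with v ≟ a | v ≟ b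
... | yes refl | _ = here (b , inj₁ refl)
... | no _ | yes refl = here (a , inj₂ refl)
... | no v≢a | no v≢b =
  there (incident (subst (1 ≤_) (cong₂ (λ p q → p + q + deg es v) (indic-≢ (v≢a ∘ sym)) (indic-≢ (v≢b ∘ sym))) pos))

SameEdge-≢ : {a b : Fin n} {e : Edge n} → SameEdge (a , b) e → proj₁ e ≢ proj₂ e → a ≢ b
SameEdge-≢ (inj₁ refl) e≢ = e≢
SameEdge-≢ (inj₂ refl) e≢ a≡b = e≢ (sym a≡b)

module _ {w : Fin n → Fin n → ℕ} (metric : IsMetric w) where
  open IsMetric metric

  detachEdgeAt : {es : EdgeList n} {v : Fin n} → NoLoops es → 1 ≤ deg es v →
    ∃ λ x → ∃ λ rest → v ≢ x × NoLoops rest × (∀ u → deg es u ≡ ends (v , x) u + deg rest u)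
      × weight w es ≡ w v x + weight w rest × length es ≡ suc (length rest)
  detachEdgeAt noLoops pos with extractAny (incident pos)
  ... | e , rest , (x , vx~e) , es↭ with All-resp-↭ es↭ noLoops
  ...   | e-noLoop ∷ rest-noLoops =
    x , rest , SameEdge-≢ vx~e e-noLoop , rest-noLoops ,
    (λ u → trans (deg-↭ es↭ u) (cong (_+ deg rest u) (sym (ends-SameEdge vx~e u)))) ,
    trans (weight-↭ w es↭) (cong (_+ weight w rest) (sym (weight-SameEdge metric vx~e))) ,
    ↭-length es↭

  -- Replace two edges v x, v y at a vertex of degree ≥ 2 by the edge x y (or by nothing if x = y):
  -- parities are unchanged and, by the triangle inequality, the weight does not grow.
  shortcutStep : {Z : EdgeList n} {v : Fin n} → NoLoops Z → 2 ≤ deg Z v →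
    ∃ λ Z′ → NoLoops Z′ × SameParity Z′ Z × weight w Z′ ≤ weight w Z × length Z′ < length Z
  shortcutStep {Z} {v} noLoops 2≤deg with detachEdgeAt noLoops (≤-trans (s≤s z≤n) 2≤deg)
  ... | x , R , v≢x , R-noLoops , degZ , weightZ , lengthZ
    with detachEdgeAt R-noLoops (≤-pred (subst (2 ≤_) (trans (degZ v) (cong₂ (λ p q → p + q + deg R v) (indic-refl v) (indic-≢ (v≢x ∘ sym)))) 2≤deg))
  ... | y , R₂ , _ , R₂-noLoops , degR , weightR , lengthR with x ≟ y
  ... | yes refl = R₂ , R₂-noLoops , parity , weight≤ , ≤-trans (n≤1+n _) (≤-reflexive (sym (trans lengthZ (cong suc lengthR))))
    where
    parity : SameParity R₂ Z
    parity u = ≡₂-sym (≡₂-trans (≡⇒≡₂ (trans (degZ u) (cong (ends (v , x) u +_) (degR u))))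
                               (m+[m+n]≡₂n (ends (v , x) u) (deg R₂ u)))
    weight≤ : weight w R₂ ≤ weight w Z
    weight≤ = begin
      weight w R₂                    ≤⟨ m≤n+m _ (w v x + w v x) ⟩
      w v x + w v x + weight w R₂    ≡⟨ +-assoc (w v x) (w v x) (weight w R₂) ⟩
      w v x + (w v x + weight w R₂)  ≡⟨ trans weightZ (cong (w v x +_) weightR) ⟨
      weight w Z                     ∎
      where open ≤-Reasoning
  ... | no x≢y = (x , y) ∷ R₂ , x≢y ∷ R₂-noLoops , parity , weight≤ , ≤-reflexive (sym (trans lengthZ (cong suc lengthR)))
    where
    parity : SameParity ((x , y) ∷ R₂) Z
    parity u = ≡₂-sym (≡₂-trans (≡⇒≡₂ (begin
      deg Z u                                      ≡⟨ trans (degZ u) (cong (ends (v , x) u +_) (degR u)) ⟩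
      ends (v , x) u + (ends (v , y) u + deg R₂ u) ≡⟨ solve 4 (λ V X Y d → (V :+ X) :+ ((V :+ Y) :+ d) := V :+ (V :+ ((X :+ Y) :+ d))) refl (indic v u) (indic x u) (indic y u) (deg R₂ u) ⟩
      indic v u + (indic v u + deg ((x , y) ∷ R₂) u) ∎))
      (m+[m+n]≡₂n (indic v u) (deg ((x , y) ∷ R₂) u)))
      where open ≡-Reasoning
    weight≤ : weight w ((x , y) ∷ R₂) ≤ weight w Z
    weight≤ = begin
      w x y + weight w R₂            ≤⟨ +-monoˡ-≤ (weight w R₂) (triangle x v y) ⟩
      w x v + w v y + weight w R₂    ≡⟨ cong (λ d → d + w v y + weight w R₂) (symmetric x v) ⟩
      w v x + w v y + weight w R₂    ≡⟨ +-assoc (w v x) (w v y) (weight w R₂) ⟩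
      w v x + (w v y + weight w R₂)  ≡⟨ trans weightZ (cong (w v x +_) weightR) ⟨
      weight w Z                     ∎
      where open ≤-Reasoning

  shortcut : (fuel : ℕ) (Z : EdgeList n) → length Z ≤ fuel → NoLoops Z →
    ∃ λ M → NoLoops M × (∀ v → deg M v ≤ 1) × SameParity M Z × weight w M ≤ weight w Z
  shortcut fuel Z bound noLoops with any? (λ v → 2 ≤? deg Z v)
  ... | no none = Z , noLoops , (λ v → ≤-pred (≰⇒> (λ 2≤ → none (v , 2≤)))) , (λ v → ≡⇒≡₂ refl) , ≤-refl
  ... | yes (v , 2≤deg) with shortcutStep noLoops 2≤deg | fuel
  ...   | _ , _ , _ , _ , shorter | zero with () ← <-≤-trans shorter bound
  ...   | Z′ , Z′-noLoops , parity′ , weight′ , shorter | suc fuel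
    with shortcut fuel Z′ (≤-pred (<-≤-trans shorter bound)) Z′-noLoops
  ... | M , M-noLoops , deg≤1 , parity , weight≤ =
    M , M-noLoops , deg≤1 , (λ u → ≡₂-trans (parity u) (parity′ u)) , ≤-trans weight≤ weight′

  parityShortcut : {Z : EdgeList n} → NoLoops Z →
    ∃ λ M → NoLoops M × (∀ v → deg M v ≡ deg Z v % 2) × weight w M ≤ weight w Z
  parityShortcut {Z} noLoops with shortcut (length Z) Z ≤-refl noLoops
  ... | M , M-noLoops , deg≤1 , parity , weight≤ = M , M-noLoops , (λ v → ≤1∧≡₂⇒≡%2 (deg≤1 v) (parity v)) , weight≤

-- Parity joins

2*m≤m+n : ∀ {m n} → m ≤ n → 2 * m ≤ m + n
2*m≤m+n {m} m≤n = +-monoʳ-≤ m (≤-trans (≤-reflexive (+-identityʳ m)) m≤n)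

-- For connected H, parityJoin distributes the edges of H between J and K so that J gets the
-- degree parities of Y: for every edge a b of Y, walk from a to b in H and move each traversed edge
-- to the other side, which flips the parity of J exactly at a and b.
infix 4 _∣_by_
record Bipartition (H : EdgeList n) : Set where
  constructor _∣_by_
  field
    left right : EdgeList n
    split : H ↭ left ++ right
open Bipartition

module _ {H : EdgeList n} where

  moveEdge : (P : Bipartition H) {a b : Fin n} → EdgeIn (a , b) H →
    ∃ λ (P′ : Bipartition H) → SameParity (left P′) ((a , b) ∷ left P)
  moveEdge (J ∣ K by H↭) {a} {b} ab∈H with Any.++⁻ J (Any-resp-↭ H↭ ab∈H)
  ... | inj₁ ab∈J with extractAny ab∈J
  ...   | e , J′ , ab~e , J↭ = (J′ ∣ e ∷ K by ↭-trans H↭ (↭-trans (++⁺ʳ K J↭) (↭-sym (shift e J′ K)))) , parity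
    where
    parity : SameParity J′ ((a , b) ∷ J)
    parity u = ≡₂-sym (≡₂-trans
      (≡⇒≡₂ (cong (ends (a , b) u +_) (trans (deg-↭ J↭ u) (cong (_+ deg J′ u) (sym (ends-SameEdge ab~e u))))))
      (m+[m+n]≡₂n (ends (a , b) u) (deg J′ u)))
  moveEdge (J ∣ K by H↭) {a} {b} ab∈H | inj₂ ab∈K with extractAny ab∈K
  ...   | e , K′ , ab~e , K↭ = (e ∷ J ∣ K′ by ↭-trans H↭ (↭-trans (++⁺ˡ J K↭) (shift e J K′))) ,
          λ u → ≡⇒≡₂ (cong (_+ deg J u) (sym (ends-SameEdge ab~e u)))

  moveAlong : (P : Bipartition H) {a b : Fin n} → Connected H a b →
    ∃ λ (P′ : Bipartition H) → SameParity (left P′) ((a , b) ∷ left P)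
  moveAlong P {a} here = P , λ u →
    ≡₂-sym (≡₂-trans (≡⇒≡₂ (+-assoc (indic a u) (indic a u) (deg (left P) u))) (m+[m+n]≡₂n (indic a u) (deg (left P) u)))
  moveAlong P {a} {b} (step {x = x} ax∈H x~b) with moveEdge P ax∈H
  ... | P₁ , parity₁ with moveAlong P₁ x~b
  ...   | P₂ , parity₂ = P₂ , λ u → ≡₂-trans (parity₂ u)
          (≡₂-trans (+-congˡ-≡₂ (ends (x , b) u) (parity₁ u))
            (≡₂-trans (≡⇒≡₂ (solve 4 (λ A X B d → (X :+ B) :+ ((A :+ X) :+ d) := X :+ (X :+ ((A :+ B) :+ d)))
                                     refl (indic a u) (indic x u) (indic b u) (deg (left P) u)))
              (m+[m+n]≡₂n (indic x u) (deg ((a , b) ∷ left P) u))))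

  parityJoin : (∀ a b → Connected H a b) → (Y : EdgeList n) → ∃ λ (P : Bipartition H) → SameParity (left P) Y
  parityJoin connected [] = ([] ∣ H by ↭-refl) , λ u → ≡⇒≡₂ refl
  parityJoin connected ((a , b) ∷ Y) with parityJoin connected Y
  ... | P₀ , parity₀ with moveAlong P₀ (connected a b)
  ...   | P , parity = P , λ u → ≡₂-trans (parity u) (+-congˡ-≡₂ (ends (a , b) u) (parity₀ u))

  -- As H is even, the complement K of J has the parities of Y too; take the lighter of J and K.
  halfParityJoin : (w : Fin n → Fin n → ℕ) → (∀ a b → Connected H a b) → NoLoops H → AllEven H →
    (Y : EdgeList n) → ∃ λ Z → NoLoops Z × SameParity Z Y × 2 * weight w Z ≤ weight w H
  halfParityJoin w connected noLoops even Y with parityJoin connected Y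
  ... | (J ∣ K by H↭) , parityJ with All.++⁻ J (All-resp-↭ H↭ noLoops) | weight w J ≤? weight w K
  ...   | J-noLoops , _ | yes J≤K = J , J-noLoops , parityJ , ≤-trans (2*m≤m+n J≤K) (≤-reflexive weightH)
    where
    weightH : weight w J + weight w K ≡ weight w H
    weightH = sym (trans (weight-↭ w H↭) (weight-++ w J K))
  ...   | _ , K-noLoops | no J≰K = K , K-noLoops , parityK ,
            ≤-trans (2*m≤m+n (≰⇒≥ J≰K)) (≤-reflexive (trans (+-comm (weight w K) (weight w J)) weightH))
    where
    weightH : weight w J + weight w K ≡ weight w H
    weightH = sym (trans (weight-↭ w H↭) (weight-++ w J K))
    parityK : SameParity K Y
    parityK u = ≡₂-trans (≡₂-sym (m+[m+n]≡₂n (deg J u) (deg K u)))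
      (≡₂-trans (+-congˡ-≡₂ (deg J u) (≡₂-trans (≡⇒≡₂ (sym (trans (deg-↭ H↭ u) (deg-++ J K u)))) (mod2 (even u))))
        (≡₂-trans (≡⇒≡₂ (+-identityʳ (deg J u))) (parityJ u)))

-- Connecting the components of a tour

subsetOf : {P : Fin n → Set} → (∀ v → Dec (P v)) → Subset n
subsetOf P? = tabulate (λ v → does (P? v))

module _ {P : Fin n → Set} (P? : ∀ v → Dec (P v)) {v : Fin n} where

  ∈-subsetOf⁺ : P v → v ∈ subsetOf P?
  ∈-subsetOf⁺ p = lookup⇒[]= v (subsetOf P?) (trans (lookup∘tabulate (λ u → does (P? u)) v) (dec-true (P? v) p))

  ∈-subsetOf⁻ : v ∈ subsetOf P? → P v
  ∈-subsetOf⁻ v∈ with P? v | trans (sym (lookup∘tabulate (λ u → does (P? u)) v)) ([]=⇒lookup v∈)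
  ... | yes p | _ = p
  ... | no _ | ()

module _ {D : Subset n} {w : Fin n → Fin n → ℕ} {L : ℕ} (cutBound : CutBound w L) {d₀ : Fin n} (d₀∈D : d₀ ∈ D) where

  unreached? : (H : EdgeList n) (d : Fin n) → Dec (d ∈ D × ¬ Connected H d₀ d)
  unreached? H d = (d ∈? D) ×-dec ¬? (connected? H d₀ d)

  Unreached : EdgeList n → Subset n
  Unreached H = subsetOf (unreached? H)

  unreached⊂depots : (H : EdgeList n) → Unreached H ⊂ D
  unreached⊂depots H = (λ d∈ → proj₁ (∈-subsetOf⁻ (unreached? H) d∈)) , d₀ , d₀∈D , (λ d₀∈ → proj₂ (∈-subsetOf⁻ (unreached? H) d₀∈) here)

  allReached⇒connected : {H : EdgeList n} → ComponentsHaveDepot D H → (∀ d → ¬ (d ∈ D × ¬ Connected H d₀ d)) →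
    ∀ a b → Connected H a b
  allReached⇒connected {H} depots reached a b = connected-trans (toRoot a) (connected-sym (toRoot b))
    where
    toRoot : ∀ x → Connected H x d₀
    toRoot x with depots x
    ... | d , d∈D , x~d with connected? H d₀ d
    ...   | yes d₀~d = connected-trans x~d (connected-sym d₀~d)
    ...   | no d₀≁d = contradiction (d∈D , d₀≁d) (reached d)

  bridge : {H : EdgeList n} → ComponentsHaveDepot D H → {d : Fin n} → ¬ Connected H d₀ d →
    ∃₂ λ u v → u ≢ v × w u v ≤ L × Unreached ((u , v) ∷ (u , v) ∷ H) ⊂ Unreached H
  bridge {H} depots {d} d₀≁d with cutBound (subsetOf (connected? H d₀)) (d₀ , ∈-subsetOf⁺ (connected? H d₀) here) (d , d₀≁d ∘ ∈-subsetOf⁻ (connected? H d₀))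
  ... | u , v , u∈ , v∉ , uv≤L = u , v , u≢v , uv≤L , fewerUnreached
    where
    d₀~u : Connected H d₀ u
    d₀~u = ∈-subsetOf⁻ (connected? H d₀) u∈
    d₀≁v : ¬ Connected H d₀ v
    d₀≁v = v∉ ∘ ∈-subsetOf⁺ (connected? H d₀)
    u≢v : u ≢ v
    u≢v refl = d₀≁v d₀~u
    H₁ : EdgeList n
    H₁ = (u , v) ∷ (u , v) ∷ H
    lift : ∀ {x y} → Connected H x y → Connected H₁ x y
    lift = connected-∷ ∘ connected-∷
    fewerUnreached : Unreached H₁ ⊂ Unreached H
    fewerUnreached with depots v
    ... | dᵥ , dᵥ∈D , v~dᵥ =
      (λ x∈ → let x∈D , unreached = ∈-subsetOf⁻ (unreached? H₁) x∈ in ∈-subsetOf⁺ (unreached? H) (x∈D , unreached ∘ lift)) ,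
      dᵥ , ∈-subsetOf⁺ (unreached? H) (dᵥ∈D , λ d₀~dᵥ → d₀≁v (connected-trans d₀~dᵥ (connected-sym v~dᵥ))) ,
      (λ dᵥ∈ → proj₂ (∈-subsetOf⁻ (unreached? H₁) dᵥ∈) (connected-trans (lift d₀~u) (step (here (inj₁ refl)) (lift v~dᵥ))))

  connectComponents : (fuel : ℕ) (H : EdgeList n) → ∣ Unreached H ∣ ≤ fuel → ComponentsHaveDepot D H → NoLoops H →
    ∃ λ H′ → NoLoops H′ × SameParity H′ H × weight w H′ ≤ weight w H + 2 * (L * fuel) × (∀ a b → Connected H′ a b)
  connectComponents fuel H bound depots noLoops with any? (unreached? H)
  ... | no none = H , noLoops , (λ _ → ≡⇒≡₂ refl) , m≤m+n _ _ , allReached⇒connected depots (λ d → none ∘ (d ,_))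
  ... | yes (d , _ , d₀≁d) with bridge depots d₀≁d | fuel
  ...   | _ , _ , _ , _ , fewer | zero with () ← <-≤-trans (p⊂q⇒∣p∣<∣q∣ fewer) bound
  ...   | u , v , u≢v , uv≤L , fewer | suc fuel
    with connectComponents fuel ((u , v) ∷ (u , v) ∷ H) (≤-pred (<-≤-trans (p⊂q⇒∣p∣<∣q∣ fewer) bound))
           (λ x → let d′ , d′∈D , x~d′ = depots x in d′ , d′∈D , connected-∷ (connected-∷ x~d′))
           (u≢v ∷ u≢v ∷ noLoops)
  ... | H′ , H′-noLoops , parity , weight≤ , connected =
    H′ , H′-noLoops , (λ x → ≡₂-trans (parity x) (m+[m+n]≡₂n (ends (u , v) x) (deg H x))) , weight≤′ , connected
    where
    weight≤′ : weight w H′ ≤ weight w H + 2 * (L * suc fuel)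
    weight≤′ = begin
      weight w H′                                   ≤⟨ weight≤ ⟩
      w u v + (w u v + weight w H) + 2 * (L * fuel) ≤⟨ +-monoˡ-≤ (2 * (L * fuel)) (+-mono-≤ uv≤L (+-monoˡ-≤ (weight w H) uv≤L)) ⟩
      L + (L + weight w H) + 2 * (L * fuel)         ≡⟨ solve 3 (λ L W k → (L :+ (L :+ W)) :+ con 2 :* (L :* k) := W :+ con 2 :* (L :* (con 1 :+ k))) refl L (weight w H) fuel ⟩
      weight w H + 2 * (L * suc fuel)               ∎
      where open ≤-Reasoning

-- The Christofides–Serdyukov tour

endpoints-positive : (M : EdgeList n) → All (λ e → 1 ≤ deg M (proj₁ e) × 1 ≤ deg M (proj₂ e)) M
endpoints-positive M = All.tabulate positive
  where
  positive : ∀ {e} → e List.∈ M → 1 ≤ deg M (proj₁ e) × 1 ≤ deg M (proj₂ e)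
  positive e∈M with extractAny e∈M
  ... | (a , b) , rest , refl , M↭ =
    subst (1 ≤_) (sym (deg-↭ M↭ a)) (≤-trans (≤-reflexive (sym (indic-refl a))) (≤-trans (m≤m+n (indic a a) (indic b a)) (m≤m+n _ (deg rest a)))) ,
    subst (1 ≤_) (sym (deg-↭ M↭ b)) (≤-trans (≤-reflexive (sym (indic-refl b))) (≤-trans (m≤n+m (indic b b) (indic a b)) (m≤m+n _ (deg rest b))))

module _ {F : EdgeList n} where

  evenVertex-unmatched : {M : EdgeList n} → All (λ e → OddDeg F (proj₁ e) × OddDeg F (proj₂ e)) M →
    ∀ {v} → deg F v % 2 ≡ 0 → deg M v ≡ 0
  evenVertex-unmatched [] even = refl
  evenVertex-unmatched {(a , b) ∷ M} ((odd-a , odd-b) ∷ odds) {v} even =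
    trans (cong₂ (λ p q → p + q + deg M v) (indic-≢ (odd≢even odd-a)) (indic-≢ (odd≢even odd-b))) (evenVertex-unmatched odds even)
    where
    odd≢even : ∀ {x} → OddDeg F x → x ≢ v
    odd≢even odd refl = 0≢1+n (trans (sym even) odd)

  christofidesSerdyukov-isTour : {D : Subset n} {M : EdgeList n} → IsCSF D F → IsPerfectMatchingOnOdd F M → IsTour D (F ++ M)
  christofidesSerdyukov-isTour {M = M} ((F-noLoops , _) , depots) (M-noLoops , odds , matched) =
    All.++⁺ F-noLoops M-noLoops , even , λ v → let d , d∈D , v~d = depots v in d , d∈D , connected-mono (Any.++⁺ˡ) v~d
    where
    even : AllEven (F ++ M)
    even v with %2≡0⊎%2≡1 (deg F v)
    ... | inj₁ F-even = begin
      deg (F ++ M) v % 2      ≡⟨ cong (_% 2) (trans (deg-++ F M v) (cong (deg F v +_) (evenVertex-unmatched odds F-even))) ⟩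
      (deg F v + 0) % 2       ≡⟨ cong (_% 2) (+-identityʳ (deg F v)) ⟩
      deg F v % 2             ≡⟨ F-even ⟩
      0                       ∎
      where open ≡-Reasoning
    ... | inj₂ F-odd = begin
      deg (F ++ M) v % 2      ≡⟨ cong (_% 2) (trans (deg-++ F M v) (cong (deg F v +_) (matched v F-odd))) ⟩
      (deg F v + 1) % 2       ≡⟨ %-distribˡ-+ (deg F v) 1 2 ⟩
      (deg F v % 2 + 1) % 2   ≡⟨ cong (λ r → (r + 1) % 2) F-odd ⟩
      0                       ∎
      where open ≡-Reasoning

  parity⇒perfectMatchingOnOdd : {M : EdgeList n} → NoLoops M → (∀ v → deg M v ≡ deg F v % 2) → IsPerfectMatchingOnOdd F M
  parity⇒perfectMatchingOnOdd {M} noLoops deg≡ =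
    noLoops , All.map (λ (pos-a , pos-b) → odd pos-a , odd pos-b) (endpoints-positive M) , λ v odd → trans (deg≡ v) odd
    where
    odd : ∀ {v} → 1 ≤ deg M v → OddDeg F v
    odd {v} pos with %2≡0⊎%2≡1 (deg F v)
    ... | inj₁ even = contradiction (subst (1 ≤_) (trans (deg≡ v) even) pos) λ ()
    ... | inj₂ odd = odd

2[f+m]≤3t+c : ∀ {f m h t c} → f ≤ t → 2 * m ≤ h → h ≤ t + c → 2 * (f + m) ≤ 3 * t + c
2[f+m]≤3t+c {f} {m} {h} {t} {c} f≤t 2m≤h h≤t+c = begin
  2 * (f + m)       ≡⟨ *-distribˡ-+ 2 f m ⟩
  2 * f + 2 * m     ≤⟨ +-mono-≤ (*-monoʳ-≤ 2 f≤t) (≤-trans 2m≤h h≤t+c) ⟩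
  2 * t + (t + c)   ≡⟨ solve 2 (λ t c → con 2 :* t :+ (t :+ c) := con 3 :* t :+ c) refl t c ⟩
  3 * t + c         ∎
  where open ≤-Reasoning

mainTheorem5 : ∀ (n : ℕ) (D : Subset n) (w : Fin n → Fin n → ℕ) (L : ℕ) →
    Nonempty D → IsMetric w → CutBound w L →
    ∀ (F M : EdgeList n) → IsMinCSF w D F → IsMinPerfectMatchingOnOdd w F M →
    IsTour D (F ++ M)
    × (∀ (T' : EdgeList n) → IsTour D T' →
    2 * weight w (F ++ M) ≤ 3 * weight w T' + 2 * (L * (∣ D ∣ ∸ 1)))
mainTheorem5 n D w L (d₀ , d₀∈D) metric cutBound F M minCSF@(csf , _) (matching , minMatching) =
  christofidesSerdyukov-isTour csf matching , bound
  where
  bound : ∀ T → IsTour D T → 2 * weight w (F ++ M) ≤ 3 * weight w T + 2 * (L * (∣ D ∣ ∸ 1))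
  bound T (T-noLoops , T-even , T-depots)
    with connectComponents cutBound d₀∈D (∣ D ∣ ∸ 1) T (∸-monoˡ-≤ 1 (p⊂q⇒∣p∣<∣q∣ (unreached⊂depots cutBound d₀∈D T))) T-depots T-noLoops
  ... | H , H-noLoops , H≡₂T , H≤ , H-connected
    with halfParityJoin w H-connected H-noLoops (λ v → trans (mod2-≡ (H≡₂T v)) (T-even v)) F
  ... | Z , Z-noLoops , Z≡₂F , 2Z≤H with parityShortcut metric Z-noLoops
  ... | M′ , M′-noLoops , M′-deg , M′≤Z =
    subst (_≤ 3 * weight w T + 2 * (L * (∣ D ∣ ∸ 1))) (cong (2 *_) (sym (weight-++ w F M)))
      (2[f+m]≤3t+c (minCSF-weight≤ minCSF T-depots) (≤-trans (*-monoʳ-≤ 2 (≤-trans M≤M′ M′≤Z)) 2Z≤H) H≤)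
    where
    M≤M′ : weight w M ≤ weight w M′
    M≤M′ = minMatching M′ (parity⇒perfectMatchingOnOdd {F = F} M′-noLoops (λ v → trans (M′-deg v) (mod2-≡ (Z≡₂F v))))
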